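{- For every $k \geq 1$, $\mathscr{I}(P_{3k+1}) \cong \mathfrak{L}_k$.
   Context: For a graph $G$, an $i$-set is an independent dominating set of minimum size. The $i$-graph $\mathscr{I}(G)$ has the $i$-sets of $G$ as vertices, with $X,Y$ adjacent if and only if there is an edge $xy\in E(G)$ with $x\in X$, $y \notin X$ and $Y=(X\setminus\{x\})\cup\{y\}$. $P_m$ is the path on $m$ vertices. The worn $k$-lattice graph $\mathfrak{L}_k$ has vertex set $\{w_{i,j} : 0 \le j \le i \le k\}$, and $w_{a,b}$ is adjacent to $w_{c,d}$ if and only if either ($a = c-1$ and $b \in \{d, d-1\}$) or ($a = c+1$ and $b \in \{d, d+1\}$). -}

module Defs where

open import Data.Nat using (ℕ; zero; suc; _+_; _≤_)
open import Data.Fin using (Fin; toℕ)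
open import Data.Fin.Subset using (Subset; _∈_; _∉_; _∪_; _-_; ⁅_⁆; ∣_∣)
open import Data.Product using (Σ; ∃; ∃-syntax; _×_; _,_)
open import Data.Sum using (_⊎_)
open import Relation.Nullary using (¬_)
open import Relation.Binary.PropositionalEquality using (_≡_)
open import Function.Bundles using (_⇔_)

Adj : ℕ → Set₁
Adj n = Fin n → Fin n → Set

PathAdj : (m : ℕ) → Adj m
PathAdj m x y = (toℕ x + 1 ≡ toℕ y) ⊎ (toℕ y + 1 ≡ toℕ x)

module _ {n : ℕ} (G : Adj n) where

  Independent : Subset n → Set
  Independent X = ∀ x y → x ∈ X → y ∈ X → ¬ G x y

  Dominating : Subset n → Set
  Dominating X = ∀ v → v ∈ X ⊎ (∃[ u ] (u ∈ X × G u v))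

  IsIDS : Subset n → Set
  IsIDS X = Independent X × Dominating X

  IsISet : Subset n → Set
  IsISet X = IsIDS X × (∀ Y → IsIDS Y → ∣ X ∣ ≤ ∣ Y ∣)

  IAdj : Subset n → Subset n → Set
  IAdj X Y = ∃[ x ] ∃[ y ] (G x y × x ∈ X × y ∉ X × Y ≡ (X - x) ∪ ⁅ y ⁆)

-- Vertices of the worn k-lattice: w_{i,j} with 0 ≤ j ≤ i ≤ k,
-- encoded as i : Fin (k+1), j : Fin (i+1).
LVert : ℕ → Set
LVert k = Σ (Fin (suc k)) (λ i → Fin (suc (toℕ i)))

LAdj : (k : ℕ) → LVert k → LVert k → Set
LAdj k (a , b) (c , d) =
    ((toℕ a + 1 ≡ toℕ c) × ((toℕ b ≡ toℕ d) ⊎ (toℕ b + 1 ≡ toℕ d)))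
  ⊎ ((toℕ a ≡ toℕ c + 1) × ((toℕ b ≡ toℕ d) ⊎ (toℕ b ≡ toℕ d + 1)))

ISetGraphIsoLattice : {n : ℕ} → Adj n → ℕ → Set
ISetGraphIsoLattice {n} G k =
  Σ (LVert k → Subset n) λ f →
      (∀ w → IsISet G (f w))
    × (∀ w w′ → f w ≡ f w′ → w ≡ w′)
    × (∀ X → IsISet G X → ∃[ w ] (f w ≡ X))
    × (∀ w w′ → LAdj k w w′ ⇔ IAdj G (f w) (f w′))

-- The characteristic word of a set of vertices of P_{3k+1}, padded with a false at both ends, has
-- length 3(k + 1). The set is independent and dominating iff the padded word has no two adjacent
-- trues and no three adjacent falses; so each of the k + 1 aligned triples of the padded word
-- contains a vertex, and an i-set has exactly one vertex per triple. The transitions allowed between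
-- consecutive triples force the padded word of an i-set to be block₂^x block₁^(y+1) block₀^z with
-- x + y + z = k, where blockᵢ has its true at offset i, and w_{a,b} ↦ (a - b, k - a, b) is a
-- bijection onto these words. An i-graph edge moves one vertex to a neighbouring position. The sum
-- over the vertices of their triple index is the same for all i-sets, so the moved vertex stays in
-- its triple: one block₁ turns into a block₂ or a block₀, or back, which is exactly a lattice edge.

module Submission where

open import Defs
open import Data.Bool using (Bool; true; false; _∧_; _∨_; not; if_then_else_)
open import Data.Empty using (⊥; ⊥-elim)
open import Data.Fin using (Fin; zero; suc; toℕ; fromℕ<)
open import Data.Fin.Properties using (toℕ-fromℕ<; toℕ<n; toℕ-injective)
open import Data.Fin.Subset using (Subset; _∈_; _∉_; _∪_; _-_; ⁅_⁆; ∣_∣)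
open import Data.Fin.Subset.Properties using (p─⊥≡p; ∪-identityʳ)
open import Data.List using (List; []; _∷_; _++_; length; [_])
open import Data.List.Properties using (++-assoc; ++-identityʳ; ∷-injectiveʳ; ∷ʳ-injective; length-++)
open import Data.Nat using (ℕ; zero; suc; _+_; _*_; _∸_; _≤_; _<_; z≤n; s≤s; _≡ᵇ_)
open import Data.Nat.Properties
open import Algebra.Properties.CommutativeSemigroup +-commutativeSemigroup using (xy∙z≈xz∙y)
open import Data.Nat.Tactic.RingSolver using (solve-∀)
open import Data.Product using (Σ; ∃-syntax; _×_; _,_; proj₁; proj₂; swap)
open import Data.Sum using (_⊎_; inj₁; inj₂) renaming (map to map⊎; swap to swap⊎)
open import Data.Vec using ([]; _∷_; here; there; toList; fromList; cast)
open import Data.Vec.Properties using (toList-injective; toList-cast; toList∘fromList; cast-is-id; length-toList)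
open import Function using (_∘_)
open import Function.Bundles using (mk⇔)
open import Relation.Binary.PropositionalEquality hiding ([_])
open ≡-Reasoning

private
  variable
    k n m n₀ n₂ : ℕ

-- Reading past the end of a list yields false, so padding with false is invisible to bit.
bit : List Bool → ℕ → Bool
bit []       i       = false
bit (b ∷ bs) zero    = b
bit (b ∷ bs) (suc i) = bit bs i

_[_]≔_ : List Bool → ℕ → Bool → List Bool
[]       [ i     ]≔ c = []
(b ∷ bs) [ zero  ]≔ c = c ∷ bs
(b ∷ bs) [ suc i ]≔ c = b ∷ (bs [ i ]≔ c)

trues : List Bool → ℕ
trues []           = 0
trues (true ∷ bs)  = suc (trues bs)
trues (false ∷ bs) = trues bs

bit-true⇒< : ∀ bs i → bit bs i ≡ true → i < length bs
bit-true⇒< (b ∷ bs) zero    _ = s≤s z≤n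
bit-true⇒< (b ∷ bs) (suc i) e = s≤s (bit-true⇒< bs i e)

bit-++ʳ : ∀ bs cs i → bit (bs ++ cs) (length bs + i) ≡ bit cs i
bit-++ʳ []       cs i = refl
bit-++ʳ (b ∷ bs) cs i = bit-++ʳ bs cs i

≔-++ʳ : ∀ bs cs i c → (bs ++ cs) [ length bs + i ]≔ c ≡ bs ++ (cs [ i ]≔ c)
≔-++ʳ []       cs i c = refl
≔-++ʳ (b ∷ bs) cs i c = cong (b ∷_) (≔-++ʳ bs cs i c)

length-≔ : ∀ bs i c → length (bs [ i ]≔ c) ≡ length bs
length-≔ []       i       c = refl
length-≔ (b ∷ bs) zero    c = refl
length-≔ (b ∷ bs) (suc i) c = cong suc (length-≔ bs i c)

bit-≔-false : ∀ bs i j → bit bs j ≡ false → bit (bs [ i ]≔ false) j ≡ false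
bit-≔-false []       i       j       e = refl
bit-≔-false (b ∷ bs) zero    zero    e = refl
bit-≔-false (b ∷ bs) zero    (suc j) e = e
bit-≔-false (b ∷ bs) (suc i) zero    e = e
bit-≔-false (b ∷ bs) (suc i) (suc j) e = bit-≔-false bs i j e

bit-false∷⁻ : ∀ bs j → bit (false ∷ bs) j ≡ true → ∃[ i ] (j ≡ suc i × bit bs i ≡ true)
bit-false∷⁻ bs (suc i) e = i , refl , e

pad : List Bool → List Bool
pad bs = false ∷ bs ++ [ false ]

bit-∷ʳ-false : ∀ bs i → bit (bs ++ [ false ]) i ≡ bit bs i
bit-∷ʳ-false []       zero    = refl
bit-∷ʳ-false []       (suc i) = refl
bit-∷ʳ-false (b ∷ bs) zero    = refl
bit-∷ʳ-false (b ∷ bs) (suc i) = bit-∷ʳ-false bs i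

bit-pad : ∀ bs i → bit (pad bs) i ≡ bit (false ∷ bs) i
bit-pad bs zero    = refl
bit-pad bs (suc i) = bit-∷ʳ-false bs i

length-pad : ∀ bs → length (pad bs) ≡ 2 + length bs
length-pad bs = cong suc (trans (length-++ bs) (+-comm (length bs) 1))

trues-pad : ∀ bs → trues (pad bs) ≡ trues bs
trues-pad []           = refl
trues-pad (true ∷ bs)  = cong suc (trues-pad bs)
trues-pad (false ∷ bs) = trues-pad bs

pad-injective : ∀ {bs cs} → pad bs ≡ pad cs → bs ≡ cs
pad-injective {bs} {cs} e = proj₁ (∷ʳ-injective bs cs (∷-injectiveʳ e))

lastOr : Bool → List Bool → Bool
lastOr d []       = d
lastOr d (c ∷ cs) = lastOr c cs

lastOr-pad : ∀ d bs → lastOr d (pad bs) ≡ false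
lastOr-pad d bs = go false bs
  where
  go : ∀ d bs → lastOr d (bs ++ [ false ]) ≡ false
  go d []       = refl
  go d (b ∷ bs) = go b bs

repeat : ℕ → List Bool → List Bool
repeat zero    bs = []
repeat (suc n) bs = bs ++ repeat n bs

repeat-rotate : ∀ n a b d cs → d ∷ (repeat n (a ∷ b ∷ d ∷ []) ++ cs) ≡ repeat n (d ∷ a ∷ b ∷ []) ++ d ∷ cs
repeat-rotate zero    a b d cs = refl
repeat-rotate (suc n) a b d cs = cong (λ t → d ∷ a ∷ b ∷ t) (repeat-rotate n a b d cs)

repeat-∷ʳ : ∀ n a b c cs →
            repeat n (a ∷ b ∷ c ∷ []) ++ a ∷ b ∷ c ∷ cs ≡ a ∷ b ∷ c ∷ (repeat n (a ∷ b ∷ c ∷ []) ++ cs)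
repeat-∷ʳ zero    a b c cs = refl
repeat-∷ʳ (suc n) a b c cs = cong (λ t → a ∷ b ∷ c ∷ t) (repeat-∷ʳ n a b c cs)

∈⇒bit : (X : Subset n) (x : Fin n) → x ∈ X → bit (toList X) (toℕ x) ≡ true
∈⇒bit (_ ∷ X) zero    here      = refl
∈⇒bit (_ ∷ X) (suc x) (there p) = ∈⇒bit X x p

∉⇒bit : (X : Subset n) (x : Fin n) → x ∉ X → bit (toList X) (toℕ x) ≡ false
∉⇒bit (true ∷ X)  zero    x∉X = ⊥-elim (x∉X here)
∉⇒bit (false ∷ X) zero    x∉X = refl
∉⇒bit (_ ∷ X)     (suc x) x∉X = ∉⇒bit X x (x∉X ∘ there)

bit⇒∈ : (X : Subset n) (x : Fin n) → bit (toList X) (toℕ x) ≡ true → x ∈ X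
bit⇒∈ (true ∷ X) zero    refl = here
bit⇒∈ (_ ∷ X)    (suc x) e    = there (bit⇒∈ X x e)

bit⇒element : ∀ {n} (X : Subset n) (i : ℕ) → bit (toList X) i ≡ true → ∃[ x ] (toℕ x ≡ i × x ∈ X)
bit⇒element {n} X i e =
  x , toℕ-fromℕ< i<n , bit⇒∈ X x (subst (λ j → bit (toList X) j ≡ true) (sym (toℕ-fromℕ< i<n)) e)
  where
  i<n : i < n
  i<n = subst (i <_) (length-toList X) (bit-true⇒< (toList X) i e)
  x : Fin n
  x = fromℕ< i<n

∣∣≡trues : (X : Subset n) → ∣ X ∣ ≡ trues (toList X)
∣∣≡trues []          = refl
∣∣≡trues (true ∷ X)  = cong suc (∣∣≡trues X)
∣∣≡trues (false ∷ X) = ∣∣≡trues X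

toList-remove : (X : Subset n) (x : Fin n) → toList (X - x) ≡ toList X [ toℕ x ]≔ false
toList-remove (b ∷ X) zero    = cong (λ Y → false ∷ toList Y) (p─⊥≡p X)
toList-remove (b ∷ X) (suc x) = cong (b ∷_) (toList-remove X x)

toList-insert : (X : Subset n) (x : Fin n) → toList (X ∪ ⁅ x ⁆) ≡ toList X [ toℕ x ]≔ true
toList-insert (true ∷ X)  zero    = cong (λ Y → true ∷ toList Y) (∪-identityʳ X)
toList-insert (false ∷ X) zero    = cong (λ Y → true ∷ toList Y) (∪-identityʳ X)
toList-insert (true ∷ X)  (suc x) = cong (true ∷_) (toList-insert X x)
toList-insert (false ∷ X) (suc x) = cong (false ∷_) (toList-insert X x)

toList-move : (X : Subset n) (u v : Fin n) → toList ((X - u) ∪ ⁅ v ⁆) ≡ (toList X [ toℕ u ]≔ false) [ toℕ v ]≔ true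
toList-move X u v = trans (toList-insert (X - u) v) (cong (_[ toℕ v ]≔ true) (toList-remove X u))

toList-injective′ : (X Y : Subset n) → toList X ≡ toList Y → X ≡ Y
toList-injective′ X Y e = trans (sym (cast-is-id refl X)) (toList-injective refl X Y e)

fromBits : (bs : List Bool) → length bs ≡ n → Subset n
fromBits bs e = cast e (fromList bs)

toList-fromBits : (bs : List Bool) (e : length bs ≡ n) → toList (fromBits bs e) ≡ bs
toList-fromBits bs e = trans (toList-cast e (fromList bs)) (toList∘fromList bs)

-- Independent dominating sets of a path

∧-true⁻ : ∀ {x y} → x ∧ y ≡ true → x ≡ true × y ≡ true
∧-true⁻ {true} e = refl , e

∨-true⁻ : ∀ {x y} → x ∨ y ≡ true → x ≡ true ⊎ y ≡ true
∨-true⁻ {true}  _ = inj₁ refl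
∨-true⁻ {false} e = inj₂ e

∨-trueˡ : ∀ {x} y → x ≡ true → x ∨ y ≡ true
∨-trueˡ y refl = refl

∨-trueʳ : ∀ x {y} → y ≡ true → x ∨ y ≡ true
∨-trueʳ true  _ = refl
∨-trueʳ false e = e

not-∧-true : ∀ x y → (x ≡ true → y ≡ true → ⊥) → not (x ∧ y) ≡ true
not-∧-true true  true  h = ⊥-elim (h refl refl)
not-∧-true true  false _ = refl
not-∧-true false _     _ = refl

not-∧-true⁻ : ∀ {x y} → not (x ∧ y) ≡ true → x ≡ true → y ≡ true → ⊥
not-∧-true⁻ () refl refl

NoAdjacentTrues : List Bool → Set
NoAdjacentTrues bs = ∀ i → bit bs i ≡ true → bit bs (suc i) ≡ true → ⊥

-- bit (false ∷ bs) i reads position i - 1.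
PathDominated : List Bool → Set
PathDominated bs = ∀ i → i < length bs → (bit (false ∷ bs) i ∨ bit bs i ∨ bit bs (suc i)) ≡ true

NoFalseTriple : List Bool → Set
NoFalseTriple bs = ∀ i → 2 + i < length bs → (bit bs i ∨ bit bs (1 + i) ∨ bit bs (2 + i)) ≡ true

-- a, b are the two letters before cs.
windowsOK : Bool → Bool → List Bool → Bool
windowsOK a b []       = true
windowsOK a b (c ∷ cs) = (not (b ∧ c) ∧ (a ∨ b ∨ c)) ∧ windowsOK b c cs

windowsOK⇒ : ∀ a b cs → windowsOK a b cs ≡ true → NoAdjacentTrues (b ∷ cs) × NoFalseTriple (a ∷ b ∷ cs)
windowsOK⇒ a b []       _ = (λ { zero _ () ; (suc i) () _ }) , (λ { i (s≤s (s≤s ())) })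
windowsOK⇒ a b (c ∷ cs) e with ∧-true⁻ {not (b ∧ c) ∧ (a ∨ b ∨ c)} e
... | here-ok , rest-ok with ∧-true⁻ {not (b ∧ c)} here-ok | windowsOK⇒ b c cs rest-ok
...   | not-bc , abc | noAdj , noTriple = noAdj′ , noTriple′
  where
  noAdj′ : NoAdjacentTrues (b ∷ c ∷ cs)
  noAdj′ zero    p    q    = not-∧-true⁻ not-bc p q
  noAdj′ (suc i) p q = noAdj i p q
  noTriple′ : NoFalseTriple (a ∷ b ∷ c ∷ cs)
  noTriple′ zero    _       = abc
  noTriple′ (suc i) (s≤s l) = noTriple i l

⇒windowsOK : ∀ a b cs → NoAdjacentTrues (b ∷ cs) → NoFalseTriple (a ∷ b ∷ cs) → windowsOK a b cs ≡ true
⇒windowsOK a b []       _     _        = refl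
⇒windowsOK a b (c ∷ cs) noAdj noTriple
  rewrite not-∧-true b c (noAdj zero) | noTriple zero (s≤s (s≤s (s≤s z≤n))) =
  ⇒windowsOK b c cs (λ i → noAdj (suc i)) (λ i l → noTriple (suc i) (s≤s l))

-- The two leading trues are dummy predecessors that make the first two window conditions vacuous.
pathIDS? : List Bool → Bool
pathIDS? bs = windowsOK true true (pad bs)

pathIDS?⇒ : ∀ bs → pathIDS? bs ≡ true → NoAdjacentTrues bs × PathDominated bs
pathIDS?⇒ bs e with windowsOK⇒ true true (pad bs) e
... | noAdj , noTriple = noAdj′ , dominated
  where
  noAdj′ : NoAdjacentTrues bs
  noAdj′ i p q = noAdj (2 + i) (trans (bit-∷ʳ-false bs i) p) (trans (bit-∷ʳ-false bs (suc i)) q)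
  dominated : PathDominated bs
  dominated i i<len with noTriple (2 + i) (s≤s (s≤s (subst (2 + i <_) (sym (length-pad bs)) (s≤s (s≤s i<len)))))
  ... | r rewrite bit-pad bs i | bit-∷ʳ-false bs i | bit-∷ʳ-false bs (suc i) = r

⇒pathIDS? : ∀ bs → NoAdjacentTrues bs → PathDominated bs → pathIDS? bs ≡ true
⇒pathIDS? bs noAdj dominated = ⇒windowsOK true true (pad bs) noAdj′ noTriple
  where
  noAdj′ : NoAdjacentTrues (true ∷ pad bs)
  noAdj′ (suc (suc i)) p q = noAdj i (trans (sym (bit-∷ʳ-false bs i)) p) (trans (sym (bit-∷ʳ-false bs (suc i))) q)
  noTriple : NoFalseTriple (true ∷ true ∷ pad bs)
  noTriple zero          _ = refl
  noTriple (suc zero)    _ = refl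
  noTriple (suc (suc i)) l rewrite bit-pad bs i | bit-∷ʳ-false bs i | bit-∷ʳ-false bs (suc i) =
    dominated i (≤-pred (≤-pred (subst (3 + i ≤_) (length-pad bs) (≤-pred (≤-pred l)))))

independent⇒ : (X : Subset n) → Independent (PathAdj n) X → NoAdjacentTrues (toList X)
independent⇒ X ind i p q with bit⇒element X i p | bit⇒element X (suc i) q
... | x , refl , x∈X | y , y≡ , y∈X = ind x y x∈X y∈X (inj₁ (trans (+-comm (toℕ x) 1) (sym y≡)))

⇒independent : (X : Subset n) → NoAdjacentTrues (toList X) → Independent (PathAdj n) X
⇒independent X noAdj x y x∈X y∈X (inj₁ x+1≡y) =
  noAdj (toℕ x) (∈⇒bit X x x∈X)
        (subst (λ i → bit (toList X) i ≡ true) (trans (sym x+1≡y) (+-comm (toℕ x) 1)) (∈⇒bit X y y∈X))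
⇒independent X noAdj x y x∈X y∈X (inj₂ y+1≡x) =
  noAdj (toℕ y) (∈⇒bit X y y∈X)
        (subst (λ i → bit (toList X) i ≡ true) (trans (sym y+1≡x) (+-comm (toℕ y) 1)) (∈⇒bit X x x∈X))

dominating⇒ : (X : Subset n) → Dominating (PathAdj n) X → PathDominated (toList X)
dominating⇒ {n} X dom i i<len = subst (λ j → (bit (false ∷ toList X) j ∨ bit (toList X) j ∨ bit (toList X) (suc j)) ≡ true)
                                  (toℕ-fromℕ< i<n) (dominated-at (fromℕ< i<n))
  where
  i<n : i < n
  i<n = subst (i <_) (length-toList X) i<len
  dominated-at : ∀ v → (bit (false ∷ toList X) (toℕ v) ∨ bit (toList X) (toℕ v) ∨ bit (toList X) (suc (toℕ v))) ≡ true
  dominated-at v with dom v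
  ... | inj₁ v∈X = ∨-trueʳ (bit (false ∷ toList X) (toℕ v)) (∨-trueˡ _ (∈⇒bit X v v∈X))
  ... | inj₂ (u , u∈X , inj₁ u+1≡v) = ∨-trueˡ _
        (subst (λ j → bit (false ∷ toList X) j ≡ true) (trans (+-comm 1 (toℕ u)) u+1≡v) (∈⇒bit X u u∈X))
  ... | inj₂ (u , u∈X , inj₂ v+1≡u) = ∨-trueʳ (bit (false ∷ toList X) (toℕ v)) (∨-trueʳ (bit (toList X) (toℕ v))
        (subst (λ j → bit (toList X) j ≡ true) (trans (sym v+1≡u) (+-comm (toℕ v) 1)) (∈⇒bit X u u∈X)))

⇒dominating : (X : Subset n) → PathDominated (toList X) → Dominating (PathAdj n) X
⇒dominating X dominated v with ∨-true⁻ (dominated (toℕ v) (subst (toℕ v <_) (sym (length-toList X)) (toℕ<n v)))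
... | inj₂ vv with ∨-true⁻ {bit (toList X) (toℕ v)} vv
...   | inj₁ here′ = inj₁ (bit⇒∈ X v here′)
...   | inj₂ right with bit⇒element X (suc (toℕ v)) right
...     | u , u≡ , u∈X = inj₂ (u , u∈X , inj₂ (trans (+-comm (toℕ v) 1) (sym u≡)))
⇒dominating X dominated v | inj₁ left with bit-false∷⁻ (toList X) (toℕ v) left
... | i , v≡1+i , bit-i with bit⇒element X i bit-i
...   | u , refl , u∈X = inj₂ (u , u∈X , inj₁ (trans (+-comm (toℕ u) 1) (sym v≡1+i)))

IsIDS⇒pathIDS? : (X : Subset n) → IsIDS (PathAdj n) X → pathIDS? (toList X) ≡ true
IsIDS⇒pathIDS? X (ind , dom) = ⇒pathIDS? (toList X) (independent⇒ X ind) (dominating⇒ X dom)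

pathIDS?⇒IsIDS : (X : Subset n) → pathIDS? (toList X) ≡ true → IsIDS (PathAdj n) X
pathIDS?⇒IsIDS X e with pathIDS?⇒ (toList X) e
... | noAdj , dominated = ⇒independent X noAdj , ⇒dominating X dominated

-- Aligned triples

windowsOK-block : ∀ a b c₁ c₂ c₃ cs → windowsOK a b (c₁ ∷ c₂ ∷ c₃ ∷ cs) ≡ true →
                  (c₁ ∨ c₂ ∨ c₃) ≡ true × windowsOK c₂ c₃ cs ≡ true
windowsOK-block a b c₁ c₂ c₃ cs ok with ∧-true⁻ {not (b ∧ c₁) ∧ (a ∨ b ∨ c₁)} ok
... | _ , ok₁ with ∧-true⁻ {not (c₁ ∧ c₂) ∧ (b ∨ c₁ ∨ c₂)} ok₁
...   | _ , ok₂ with ∧-true⁻ {not (c₂ ∧ c₃) ∧ (c₁ ∨ c₂ ∨ c₃)} ok₂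
...     | window₃ , ok₃ = proj₂ (∧-true⁻ {not (c₂ ∧ c₃)} window₃) , ok₃

trues-∷ : ∀ c cs → trues cs ≤ trues (c ∷ cs)
trues-∷ true  cs = n≤1+n _
trues-∷ false cs = ≤-refl

trues-block : ∀ c₁ c₂ c₃ cs → (c₁ ∨ c₂ ∨ c₃) ≡ true → suc (trues cs) ≤ trues (c₁ ∷ c₂ ∷ c₃ ∷ cs)
trues-block true  c₂    c₃   cs _ = s≤s (≤-trans (trues-∷ c₃ cs) (trues-∷ c₂ (c₃ ∷ cs)))
trues-block false true  c₃   cs _ = s≤s (trues-∷ c₃ cs)
trues-block false false true cs _ = ≤-refl

-- Each of the m aligned triples contains a true.
windowsOK⇒trues≥ : ∀ m a b cs → length cs ≡ m * 3 → windowsOK a b cs ≡ true → m ≤ trues cs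
windowsOK⇒trues≥ zero    a b cs               _   _  = z≤n
windowsOK⇒trues≥ (suc m) a b (c₁ ∷ c₂ ∷ c₃ ∷ cs) len ok with windowsOK-block a b c₁ c₂ c₃ cs ok
... | hit , ok′ = ≤-trans (s≤s (windowsOK⇒trues≥ m c₂ c₃ cs (suc-injective (suc-injective (suc-injective len))) ok′))
                          (trues-block c₁ c₂ c₃ cs hit)

block₀ block₁ block₂ : List Bool
block₀ = true  ∷ false ∷ false ∷ []
block₁ = false ∷ true  ∷ false ∷ []
block₂ = false ∷ false ∷ true  ∷ []

shape : ℕ → ℕ → ℕ → List Bool
shape x y z = repeat x block₂ ++ repeat (suc y) block₁ ++ repeat z block₀

-- The possible tails, after the letters a b, of a valid word with one true in each aligned triple.
TightShape : Bool → Bool → List Bool → Set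
TightShape _     true  cs = ∃[ x ] ∃[ y ] ∃[ z ] cs ≡ shape x y z
TightShape true  false cs = ∃[ y ] ∃[ z ] cs ≡ repeat y block₁ ++ repeat z block₀
TightShape false false cs = ∃[ z ] cs ≡ repeat z block₀

too-many-trues : ∀ {m t} → m ≤ t → 2 + t ≤ suc m → ⊥
too-many-trues m≤t 2+t≤1+m = <-irrefl refl (≤-trans (s≤s (s≤s m≤t)) 2+t≤1+m)

module _ (m : ℕ) (cs : List Bool)
         (ih : ∀ a b → windowsOK a b cs ≡ true → trues cs ≤ m → lastOr b cs ≡ false → TightShape a b cs)
         (lower : ∀ a b → windowsOK a b cs ≡ true → m ≤ trues cs) where

  private
    rest-ok : ∀ a b c₁ c₂ c₃ → windowsOK a b (c₁ ∷ c₂ ∷ c₃ ∷ cs) ≡ true → windowsOK c₂ c₃ cs ≡ true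
    rest-ok a b c₁ c₂ c₃ ok = proj₂ (windowsOK-block a b c₁ c₂ c₃ cs ok)

    crowded : ∀ a b c₁ c₂ c₃ → windowsOK a b (c₁ ∷ c₂ ∷ c₃ ∷ cs) ≡ true →
              2 + trues cs ≤ trues (c₁ ∷ c₂ ∷ c₃ ∷ cs) → trues (c₁ ∷ c₂ ∷ c₃ ∷ cs) ≤ suc m → ⊥
    crowded a b c₁ c₂ c₃ ok two t = too-many-trues (lower _ _ (rest-ok a b c₁ c₂ c₃ ok)) (≤-trans two t)

  tight-shape-step : ∀ a b c₁ c₂ c₃ → windowsOK a b (c₁ ∷ c₂ ∷ c₃ ∷ cs) ≡ true →
                     trues (c₁ ∷ c₂ ∷ c₃ ∷ cs) ≤ suc m → lastOr c₃ cs ≡ false → TightShape a b (c₁ ∷ c₂ ∷ c₃ ∷ cs)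
  tight-shape-step a b false false false ok _ _ with proj₁ (windowsOK-block a b false false false cs ok)
  ... | ()
  tight-shape-step a b true  true  true  ok t _ = ⊥-elim (crowded a b true true true ok (n≤1+n _) t)
  tight-shape-step a b true  true  false ok t _ = ⊥-elim (crowded a b true true false ok ≤-refl t)
  tight-shape-step a b true  false true  ok t _ = ⊥-elim (crowded a b true false true ok ≤-refl t)
  tight-shape-step a b false true  true  ok t _ = ⊥-elim (crowded a b false true true ok ≤-refl t)
  tight-shape-step a     true  false false true  ok t last
    with ih false true (rest-ok a true false false true ok) (≤-pred t) last
  ... | x , y , z , refl = suc x , y , z , refl
  tight-shape-step true  false false false true ()
  tight-shape-step false false false false true ()
  tight-shape-step a     true  false true  false ok t last
    with ih true false (rest-ok a true false true false ok) (≤-pred t) last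
  ... | y , z , refl = 0 , y , z , refl
  tight-shape-step true  false false true  false ok t last
    with ih true false (rest-ok true false false true false ok) (≤-pred t) last
  ... | y , z , refl = suc y , z , refl
  tight-shape-step false false false true  false ()
  tight-shape-step a     true  true  false false ()
  tight-shape-step true  false true  false false ok t last
    with ih false false (rest-ok true false true false false ok) (≤-pred t) last
  ... | z , refl = 0 , suc z , refl
  tight-shape-step false false true  false false ok t last
    with ih false false (rest-ok false false true false false ok) (≤-pred t) last
  ... | z , refl = suc z , refl

tight-shape : ∀ m a b cs → length cs ≡ m * 3 → windowsOK a b cs ≡ true → trues cs ≤ m → lastOr b cs ≡ false →
              TightShape a b cs
tight-shape zero    a     true  []                 _   _  _ ()
tight-shape zero    true  false []                 _   _  _ _    = 0 , 0 , refl
tight-shape zero    false false []                 _   _  _ _    = 0 , refl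
tight-shape (suc m) a     b     (c₁ ∷ c₂ ∷ c₃ ∷ cs) len ok t last =
  tight-shape-step m cs (λ a′ b′ ok′ t′ last′ → tight-shape m a′ b′ cs len′ ok′ t′ last′)
                        (λ a′ b′ ok′ → windowsOK⇒trues≥ m a′ b′ cs len′ ok′) a b c₁ c₂ c₃ ok t last
  where
  len′ : length cs ≡ m * 3
  len′ = suc-injective (suc-injective (suc-injective len))

-- Weights

weight : (ℕ → ℕ) → List Bool → ℕ
weight g []           = 0
weight g (true ∷ bs)  = g 0 + weight (g ∘ suc) bs
weight g (false ∷ bs) = weight (g ∘ suc) bs

weight-suc : ∀ g bs → weight (suc ∘ g) bs ≡ weight g bs + trues bs
weight-suc g []           = refl
weight-suc g (false ∷ bs) = weight-suc (g ∘ suc) bs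
weight-suc g (true ∷ bs)  = begin
  suc (g 0 + weight (suc ∘ g ∘ suc) bs)       ≡⟨ cong (λ w → suc (g 0 + w)) (weight-suc (g ∘ suc) bs) ⟩
  suc (g 0 + (weight (g ∘ suc) bs + trues bs)) ≡⟨ cong suc (+-assoc (g 0) _ _) ⟨
  suc (g 0 + weight (g ∘ suc) bs + trues bs)   ≡⟨ +-suc _ _ ⟨
  g 0 + weight (g ∘ suc) bs + suc (trues bs)   ∎

weight-∷ʳ-false : ∀ g bs → weight g (bs ++ [ false ]) ≡ weight g bs
weight-∷ʳ-false g []           = refl
weight-∷ʳ-false g (true ∷ bs)  = cong (g 0 +_) (weight-∷ʳ-false (g ∘ suc) bs)
weight-∷ʳ-false g (false ∷ bs) = weight-∷ʳ-false (g ∘ suc) bs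

weight-pad : ∀ g bs → weight g (pad bs) ≡ weight (g ∘ suc) bs
weight-pad g bs = weight-∷ʳ-false (g ∘ suc) bs

weight-≔-true : ∀ g bs i → i < length bs → bit bs i ≡ false → weight g (bs [ i ]≔ true) ≡ weight g bs + g i
weight-≔-true g (false ∷ bs) zero    _       refl = +-comm (g 0) _
weight-≔-true g (true ∷ bs)  (suc i) (s≤s l) e    =
  trans (cong (g 0 +_) (weight-≔-true (g ∘ suc) bs i l e)) (sym (+-assoc (g 0) _ _))
weight-≔-true g (false ∷ bs) (suc i) (s≤s l) e    = weight-≔-true (g ∘ suc) bs i l e

weight-≔-false : ∀ g bs i → bit bs i ≡ true → weight g (bs [ i ]≔ false) + g i ≡ weight g bs
weight-≔-false g (true ∷ bs)  zero    refl = +-comm (weight (g ∘ suc) bs) (g 0)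
weight-≔-false g (true ∷ bs)  (suc i) e    = trans (+-assoc (g 0) _ _) (cong (g 0 +_) (weight-≔-false (g ∘ suc) bs i e))
weight-≔-false g (false ∷ bs) (suc i) e    = weight-≔-false (g ∘ suc) bs i e

-- Every weight sees cs as bs with one true moved from position i to position j.
TrueMoved : List Bool → List Bool → ℕ → ℕ → Set
TrueMoved bs cs i j = ∀ g → weight g cs + g i ≡ weight g bs + g j

TrueMoved-sym : ∀ {bs cs i j} → TrueMoved bs cs i j → TrueMoved cs bs j i
TrueMoved-sym moved g = sym (moved g)

weight-move : ∀ bs i j → j < length bs → bit bs i ≡ true → bit bs j ≡ false →
              TrueMoved bs ((bs [ i ]≔ false) [ j ]≔ true) i j
weight-move bs i j j<len bit-i bit-j g = begin
  weight g (cleared [ j ]≔ true) + g i ≡⟨ cong (_+ g i) (weight-≔-true g cleared j j<len′ (bit-≔-false bs i j bit-j)) ⟩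
  weight g cleared + g j + g i         ≡⟨ +-assoc (weight g cleared) (g j) (g i) ⟩
  weight g cleared + (g j + g i)       ≡⟨ cong (weight g cleared +_) (+-comm (g j) (g i)) ⟩
  weight g cleared + (g i + g j)       ≡⟨ +-assoc (weight g cleared) (g i) (g j) ⟨
  weight g cleared + g i + g j         ≡⟨ cong (_+ g j) (weight-≔-false g bs i bit-i) ⟩
  weight g bs + g j                    ∎
  where
  cleared : List Bool
  cleared = bs [ i ]≔ false
  j<len′ : j < length cleared
  j<len′ = subst (j <_) (sym (length-≔ bs i false)) j<len

blockIndex : ℕ → ℕ
blockIndex (suc (suc (suc i))) = suc (blockIndex i)
blockIndex _                   = 0

offset : ℕ → ℕ
offset (suc (suc (suc i))) = offset i
offset i                   = i

atOffset : ℕ → ℕ → ℕ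
atOffset s i = if offset i ≡ᵇ s then 1 else 0

triangle : ℕ → ℕ
triangle zero    = 0
triangle (suc m) = triangle m + m

same-block : ∀ i → blockIndex i ≡ blockIndex (suc i) →
             (offset i ≡ 0 × offset (suc i) ≡ 1) ⊎ (offset i ≡ 1 × offset (suc i) ≡ 2)
same-block 0                   _ = inj₁ (refl , refl)
same-block 1                   _ = inj₂ (refl , refl)
same-block 2                   ()
same-block (suc (suc (suc i))) e = same-block i (suc-injective e)

atOffset-≡ : ∀ s i {r} → offset i ≡ r → atOffset s i ≡ (if r ≡ᵇ s then 1 else 0)
atOffset-≡ s i = cong (λ r → if r ≡ᵇ s then 1 else 0)

data Blocks : ℕ → ℕ → ℕ → List Bool → Set where
  []    : Blocks 0 0 0 []
  block₀∷_ : ∀ {m n₀ n₂ bs} → Blocks m n₀ n₂ bs → Blocks (suc m) (suc n₀) n₂ (block₀ ++ bs)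
  block₁∷_ : ∀ {m n₀ n₂ bs} → Blocks m n₀ n₂ bs → Blocks (suc m) n₀ n₂ (block₁ ++ bs)
  block₂∷_ : ∀ {m n₀ n₂ bs} → Blocks m n₀ n₂ bs → Blocks (suc m) n₀ (suc n₂) (block₂ ++ bs)

Blocks-length : ∀ {bs} → Blocks m n₀ n₂ bs → length bs ≡ m * 3
Blocks-length []          = refl
Blocks-length (block₀∷ B) = cong (3 +_) (Blocks-length B)
Blocks-length (block₁∷ B) = cong (3 +_) (Blocks-length B)
Blocks-length (block₂∷ B) = cong (3 +_) (Blocks-length B)

Blocks-trues : ∀ {bs} → Blocks m n₀ n₂ bs → trues bs ≡ m
Blocks-trues []          = refl
Blocks-trues (block₀∷ B) = cong suc (Blocks-trues B)
Blocks-trues (block₁∷ B) = cong suc (Blocks-trues B)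
Blocks-trues (block₂∷ B) = cong suc (Blocks-trues B)

-- Each triple contributes its own index, as blockIndex (3 + i) ≡ suc (blockIndex i).
Blocks-weight-blockIndex : ∀ {bs} → Blocks m n₀ n₂ bs → weight blockIndex bs ≡ triangle m
Blocks-weight-blockIndex [] = refl
Blocks-weight-blockIndex (block₀∷_ {bs = bs} B) =
  trans (weight-suc blockIndex bs) (cong₂ _+_ (Blocks-weight-blockIndex B) (Blocks-trues B))
Blocks-weight-blockIndex (block₁∷_ {bs = bs} B) =
  trans (weight-suc blockIndex bs) (cong₂ _+_ (Blocks-weight-blockIndex B) (Blocks-trues B))
Blocks-weight-blockIndex (block₂∷_ {bs = bs} B) =
  trans (weight-suc blockIndex bs) (cong₂ _+_ (Blocks-weight-blockIndex B) (Blocks-trues B))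

Blocks-weight-atOffset₀ : ∀ {bs} → Blocks m n₀ n₂ bs → weight (atOffset 0) bs ≡ n₀
Blocks-weight-atOffset₀ []          = refl
Blocks-weight-atOffset₀ (block₀∷ B) = cong suc (Blocks-weight-atOffset₀ B)
Blocks-weight-atOffset₀ (block₁∷ B) = Blocks-weight-atOffset₀ B
Blocks-weight-atOffset₀ (block₂∷ B) = Blocks-weight-atOffset₀ B

Blocks-weight-atOffset₂ : ∀ {bs} → Blocks m n₀ n₂ bs → weight (atOffset 2) bs ≡ n₂
Blocks-weight-atOffset₂ []          = refl
Blocks-weight-atOffset₂ (block₀∷ B) = Blocks-weight-atOffset₂ B
Blocks-weight-atOffset₂ (block₁∷ B) = Blocks-weight-atOffset₂ B
Blocks-weight-atOffset₂ (block₂∷ B) = cong suc (Blocks-weight-atOffset₂ B)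

repeat-Blocks₂ : ∀ {bs} x → Blocks m n₀ n₂ bs → Blocks (x + m) n₀ (x + n₂) (repeat x block₂ ++ bs)
repeat-Blocks₂ zero    B = B
repeat-Blocks₂ (suc x) B = block₂∷ repeat-Blocks₂ x B

repeat-Blocks₁ : ∀ {bs} y → Blocks m n₀ n₂ bs → Blocks (y + m) n₀ n₂ (repeat y block₁ ++ bs)
repeat-Blocks₁ zero    B = B
repeat-Blocks₁ (suc y) B = block₁∷ repeat-Blocks₁ y B

repeat-Blocks₀ : ∀ z → Blocks z z 0 (repeat z block₀)
repeat-Blocks₀ zero    = []
repeat-Blocks₀ (suc z) = block₀∷ repeat-Blocks₀ z

-- The words of the i-sets

middle-cancel : ∀ x y y′ z → x + y + z ≡ x + y′ + z → y ≡ y′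
middle-cancel x y y′ z e = +-cancelˡ-≡ x y y′ (+-cancelʳ-≡ z (x + y) (x + y′) e)

shape-size : ∀ x y z {k} → x + y + z ≡ k → x + suc y + z ≡ suc k
shape-size x y z e = trans (cong (_+ z) (+-suc x y)) (cong suc e)

shape-Blocks : ∀ x y z → Blocks (x + suc y + z) z x (shape x y z)
shape-Blocks x y z = subst₂ (λ m n₂ → Blocks m z n₂ (shape x y z)) (sym (+-assoc x (suc y) z)) (+-identityʳ x)
                            (repeat-Blocks₂ x (repeat-Blocks₁ (suc y) (repeat-Blocks₀ z)))

shape-weight-atOffset₀ : ∀ x y z → weight (atOffset 0) (shape x y z) ≡ z
shape-weight-atOffset₀ x y z = Blocks-weight-atOffset₀ (shape-Blocks x y z)

shape-weight-atOffset₂ : ∀ x y z → weight (atOffset 2) (shape x y z) ≡ x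
shape-weight-atOffset₂ x y z = Blocks-weight-atOffset₂ (shape-Blocks x y z)

shape-weight-blockIndex : ∀ x y z {k} → x + y + z ≡ k → weight blockIndex (shape x y z) ≡ triangle (suc k)
shape-weight-blockIndex x y z e = trans (Blocks-weight-blockIndex (shape-Blocks x y z)) (cong triangle (shape-size x y z e))

shape-injective : ∀ {x y z x′ y′ z′} → shape x y z ≡ shape x′ y′ z′ → x ≡ x′ × y ≡ y′ × z ≡ z′
shape-injective {x} {y} {z} {x′} {y′} {z′} e = x≡x′ , y≡y′ , z≡z′
  where
  x≡x′ : x ≡ x′
  x≡x′ = trans (sym (shape-weight-atOffset₂ x y z)) (trans (cong (weight (atOffset 2)) e) (shape-weight-atOffset₂ x′ y′ z′))
  z≡z′ : z ≡ z′
  z≡z′ = trans (sym (shape-weight-atOffset₀ x y z)) (trans (cong (weight (atOffset 0)) e) (shape-weight-atOffset₀ x′ y′ z′))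
  size : x + suc y + z ≡ x + suc y′ + z
  size = begin
    x + suc y + z        ≡⟨ Blocks-trues (shape-Blocks x y z) ⟨
    trues (shape x y z)  ≡⟨ cong trues e ⟩
    trues (shape x′ y′ z′) ≡⟨ Blocks-trues (shape-Blocks x′ y′ z′) ⟩
    x′ + suc y′ + z′     ≡⟨ cong₂ (λ p q → p + suc y′ + q) x≡x′ z≡z′ ⟨
    x + suc y′ + z       ∎
  y≡y′ : y ≡ y′
  y≡y′ = suc-injective (middle-cancel x (suc y) (suc y′) z size)

windowsOK-true-true : ∀ cs → windowsOK true true cs ≡ windowsOK false true cs
windowsOK-true-true []      = refl
windowsOK-true-true (c ∷ _) = refl

windowsOK-repeat₂ : ∀ x cs → windowsOK false true (repeat x block₂ ++ cs) ≡ windowsOK false true cs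
windowsOK-repeat₂ zero    cs = refl
windowsOK-repeat₂ (suc x) cs = windowsOK-repeat₂ x cs

windowsOK-repeat₁ : ∀ y cs → windowsOK true false (repeat y block₁ ++ cs) ≡ windowsOK true false cs
windowsOK-repeat₁ zero    cs = refl
windowsOK-repeat₁ (suc y) cs = windowsOK-repeat₁ y cs

windowsOK-repeat₀ : ∀ a z → windowsOK a false (repeat z block₀) ≡ true
windowsOK-repeat₀ a     zero    = refl
windowsOK-repeat₀ true  (suc z) = windowsOK-repeat₀ false z
windowsOK-repeat₀ false (suc z) = windowsOK-repeat₀ false z

windowsOK-shape : ∀ x y z → windowsOK true true (shape x y z) ≡ true
windowsOK-shape x y z = begin
  windowsOK true true (shape x y z)                         ≡⟨ windowsOK-true-true (shape x y z) ⟩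
  windowsOK false true (shape x y z)                        ≡⟨ windowsOK-repeat₂ x _ ⟩
  windowsOK true false (repeat y block₁ ++ repeat z block₀) ≡⟨ windowsOK-repeat₁ y _ ⟩
  windowsOK true false (repeat z block₀)                    ≡⟨ windowsOK-repeat₀ true z ⟩
  true                                                      ∎

isetWord : ℕ → ℕ → ℕ → List Bool
isetWord x y z = repeat x block₁ ++ repeat y block₀ ++ true ∷ repeat z block₁

pad-isetWord : ∀ x y z → pad (isetWord x y z) ≡ shape x y z
pad-isetWord x y z = begin
  false ∷ ((repeat x block₁ ++ repeat y block₀ ++ true ∷ R₁) ++ [ false ])
    ≡⟨ cong (false ∷_) (++-assoc (repeat x block₁) _ _) ⟩
  false ∷ (repeat x block₁ ++ (repeat y block₀ ++ true ∷ R₁) ++ [ false ])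
    ≡⟨ repeat-rotate x false true false _ ⟩
  repeat x block₂ ++ false ∷ ((repeat y block₀ ++ true ∷ R₁) ++ [ false ])
    ≡⟨ cong (λ t → repeat x block₂ ++ false ∷ t) (++-assoc (repeat y block₀) _ _) ⟩
  repeat x block₂ ++ false ∷ (repeat y block₀ ++ true ∷ (R₁ ++ [ false ]))
    ≡⟨ cong (repeat x block₂ ++_) (repeat-rotate y true false false _) ⟩
  repeat x block₂ ++ repeat y block₁ ++ false ∷ true ∷ (R₁ ++ [ false ])
    ≡⟨ cong (λ t → repeat x block₂ ++ repeat y block₁ ++ false ∷ true ∷ t) R₁-∷ʳ-false ⟩
  repeat x block₂ ++ repeat y block₁ ++ block₁ ++ repeat z block₀
    ≡⟨ cong (repeat x block₂ ++_) (repeat-∷ʳ y false true false _) ⟩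
  shape x y z ∎
  where
  R₁ : List Bool
  R₁ = repeat z block₁
  R₁-∷ʳ-false : R₁ ++ [ false ] ≡ false ∷ repeat z block₀
  R₁-∷ʳ-false = trans (sym (repeat-rotate z true false false [])) (cong (false ∷_) (++-identityʳ (repeat z block₀)))

padded-size : ∀ k → 2 + (3 * k + 1) ≡ suc k * 3
padded-size = solve-∀

padded-length : ∀ k (X : Subset (3 * k + 1)) → length (pad (toList X)) ≡ suc k * 3
padded-length k X = begin
  length (pad (toList X)) ≡⟨ length-pad (toList X) ⟩
  2 + length (toList X)   ≡⟨ cong (2 +_) (length-toList X) ⟩
  2 + (3 * k + 1)         ≡⟨ padded-size k ⟩
  suc k * 3               ∎

length-isetWord : ∀ x y z {k} → x + y + z ≡ k → length (isetWord x y z) ≡ 3 * k + 1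
length-isetWord x y z {k} e = suc-injective (suc-injective (begin
  2 + length (isetWord x y z)  ≡⟨ length-pad (isetWord x y z) ⟨
  length (pad (isetWord x y z)) ≡⟨ cong length (pad-isetWord x y z) ⟩
  length (shape x y z)         ≡⟨ Blocks-length (shape-Blocks x y z) ⟩
  (x + suc y + z) * 3          ≡⟨ cong (_* 3) (shape-size x y z e) ⟩
  suc k * 3                    ≡⟨ padded-size k ⟨
  2 + (3 * k + 1)              ∎))

IsIDS⇒size≥ : ∀ k (X : Subset (3 * k + 1)) → IsIDS (PathAdj (3 * k + 1)) X → suc k ≤ ∣ X ∣
IsIDS⇒size≥ k X ids = subst (suc k ≤_) (sym (trans (∣∣≡trues X) (sym (trues-pad (toList X)))))
  (windowsOK⇒trues≥ (suc k) true true (pad (toList X)) (padded-length k X) (IsIDS⇒pathIDS? X ids))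

small-IDS⇒shape : ∀ k (X : Subset (3 * k + 1)) → IsIDS (PathAdj (3 * k + 1)) X → ∣ X ∣ ≤ suc k →
                  ∃[ x ] ∃[ y ] ∃[ z ] (pad (toList X) ≡ shape x y z × x + y + z ≡ k)
small-IDS⇒shape k X ids small with tight-shape (suc k) true true (pad (toList X)) (padded-length k X) (IsIDS⇒pathIDS? X ids)
                                     (subst (_≤ suc k) (trans (∣∣≡trues X) (sym (trues-pad (toList X)))) small)
                                     (lastOr-pad true (toList X))
... | x , y , z , e = x , y , z , e , suc-injective (*-cancelʳ-≡ _ _ 3 size)
  where
  size : suc (x + y + z) * 3 ≡ suc k * 3
  size = begin
    suc (x + y + z) * 3        ≡⟨ cong (_* 3) (shape-size x y z refl) ⟨
    (x + suc y + z) * 3        ≡⟨ Blocks-length (shape-Blocks x y z) ⟨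
    length (shape x y z)       ≡⟨ cong length e ⟨
    length (pad (toList X))    ≡⟨ padded-length k X ⟩
    suc k * 3                  ∎

-- One triple block₁ of the padded word becomes a block₂ (x grows) or a block₀ (z grows).
Up : ℕ → ℕ → ℕ → ℕ → Set
Up x z x′ z′ = (x′ ≡ suc x × z′ ≡ z) ⊎ (x′ ≡ x × z′ ≡ suc z)

-- Block indices pin the moved true to one triple; the offset counts then tell which kind of triple changed.
shape-move : ∀ {x y z x′ y′ z′} i → x + y + z ≡ x′ + y′ + z′ →
             TrueMoved (shape x y z) (shape x′ y′ z′) i (suc i) →
             Up x z x′ z′ ⊎ Up x′ z′ x z
shape-move {x} {y} {z} {x′} {y′} {z′} i sum moved = conclude (same-block i sameBlock)
  where
  reading : ∀ g {p p′ r r′} → weight g (shape x y z) ≡ p → weight g (shape x′ y′ z′) ≡ p′ → g i ≡ r → g (suc i) ≡ r′ →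
            p′ + r ≡ p + r′
  reading g e e′ r r′ = trans (sym (cong₂ _+_ e′ r)) (trans (moved g) (cong₂ _+_ e r′))
  sameBlock : blockIndex i ≡ blockIndex (suc i)
  sameBlock = +-cancelˡ-≡ (triangle (suc (x + y + z))) _ _
    (reading blockIndex (shape-weight-blockIndex x y z refl) (shape-weight-blockIndex x′ y′ z′ (sym sum)) refl refl)
  x-reading : ∀ {r r′} → offset i ≡ r → offset (suc i) ≡ r′ →
              x′ + (if r ≡ᵇ 2 then 1 else 0) ≡ x + (if r′ ≡ᵇ 2 then 1 else 0)
  x-reading o o′ = reading (atOffset 2) (shape-weight-atOffset₂ x y z) (shape-weight-atOffset₂ x′ y′ z′)
                           (atOffset-≡ 2 i o) (atOffset-≡ 2 (suc i) o′)
  z-reading : ∀ {r r′} → offset i ≡ r → offset (suc i) ≡ r′ →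
              z′ + (if r ≡ᵇ 0 then 1 else 0) ≡ z + (if r′ ≡ᵇ 0 then 1 else 0)
  z-reading o o′ = reading (atOffset 0) (shape-weight-atOffset₀ x y z) (shape-weight-atOffset₀ x′ y′ z′)
                           (atOffset-≡ 0 i o) (atOffset-≡ 0 (suc i) o′)
  conclude : (offset i ≡ 0 × offset (suc i) ≡ 1) ⊎ (offset i ≡ 1 × offset (suc i) ≡ 2) → Up x z x′ z′ ⊎ Up x′ z′ x z
  conclude (inj₁ (o₀ , o₁)) = inj₂ (inj₂ (+-cancelʳ-≡ 0 x x′ (sym (x-reading o₀ o₁)) ,
                                          trans (sym (+-identityʳ z)) (trans (sym (z-reading o₀ o₁)) (+-comm z′ 1))))
  conclude (inj₂ (o₁ , o₂)) = inj₁ (inj₁ (trans (sym (+-identityʳ x′)) (trans (x-reading o₁ o₂) (+-comm x 1)) ,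
                                          +-cancelʳ-≡ 0 z′ z (z-reading o₁ o₂)))

ShiftRight : List Bool → List Bool → Set
ShiftRight bs cs = ∃[ P ] ∃[ S ] (bs ≡ P ++ true ∷ false ∷ S × cs ≡ P ++ false ∷ true ∷ S)

shiftRight-x : ∀ x y z → ShiftRight (isetWord x (suc y) z) (isetWord (suc x) y z)
shiftRight-x x y z = repeat x block₁ , false ∷ (repeat y block₀ ++ true ∷ repeat z block₁) ,
                     refl , sym (repeat-∷ʳ x false true false _)

shiftRight-z : ∀ x y z → ShiftRight (isetWord x y (suc z)) (isetWord x (suc y) z)
shiftRight-z x y z = repeat x block₁ ++ repeat y block₀ ++ true ∷ false ∷ [] , repeat z block₁ ,
                     sym (prefix (true ∷ false ∷ repeat z block₁)) ,
                     trans (cong (repeat x block₁ ++_) (sym (repeat-∷ʳ y true false false _)))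
                           (sym (prefix (false ∷ true ∷ repeat z block₁)))
  where
  prefix : ∀ cs → (repeat x block₁ ++ repeat y block₀ ++ true ∷ false ∷ []) ++ cs ≡
                  repeat x block₁ ++ repeat y block₀ ++ true ∷ false ∷ cs
  prefix cs = trans (++-assoc (repeat x block₁) _ cs) (cong (repeat x block₁ ++_) (++-assoc (repeat y block₀) _ cs))

-- Edges of the i-graph

IAdj⇒TrueMoved : (X Y : Subset n) → IAdj (PathAdj n) X Y →
                 ∃[ i ] ∃[ j ] ((suc i ≡ j ⊎ suc j ≡ i) × TrueMoved (pad (toList X)) (pad (toList Y)) i j)
IAdj⇒TrueMoved {n} X _ (u , v , u~v , u∈X , v∉X , refl) = suc (toℕ u) , suc (toℕ v) , neighbours u~v , moved
  where
  neighbours : PathAdj n u v → suc (suc (toℕ u)) ≡ suc (toℕ v) ⊎ suc (suc (toℕ v)) ≡ suc (toℕ u)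
  neighbours (inj₁ e) = inj₁ (cong suc (trans (+-comm 1 (toℕ u)) e))
  neighbours (inj₂ e) = inj₂ (cong suc (trans (+-comm 1 (toℕ v)) e))
  v<len : toℕ v < length (toList X)
  v<len = subst (toℕ v <_) (sym (length-toList X)) (toℕ<n v)
  moved : TrueMoved (pad (toList X)) (pad (toList ((X - u) ∪ ⁅ v ⁆))) (suc (toℕ u)) (suc (toℕ v))
  moved g = begin
    weight g (pad (toList ((X - u) ∪ ⁅ v ⁆))) + g (suc (toℕ u))
      ≡⟨ cong (_+ g (suc (toℕ u))) (weight-pad g (toList ((X - u) ∪ ⁅ v ⁆))) ⟩
    weight (g ∘ suc) (toList ((X - u) ∪ ⁅ v ⁆)) + g (suc (toℕ u))
      ≡⟨ cong (λ bs → weight (g ∘ suc) bs + g (suc (toℕ u))) (toList-move X u v) ⟩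
    weight (g ∘ suc) ((toList X [ toℕ u ]≔ false) [ toℕ v ]≔ true) + g (suc (toℕ u))
      ≡⟨ weight-move (toList X) (toℕ u) (toℕ v) v<len (∈⇒bit X u u∈X) (∉⇒bit X v v∉X) (g ∘ suc) ⟩
    weight (g ∘ suc) (toList X) + g (suc (toℕ v))
      ≡⟨ cong (_+ g (suc (toℕ v))) (weight-pad g (toList X)) ⟨
    weight g (pad (toList X)) + g (suc (toℕ v)) ∎

move⇒IAdj : (X Y : Subset n) (i j : ℕ) → i + 1 ≡ j ⊎ j + 1 ≡ i → bit (toList X) i ≡ true → bit (toList X) j ≡ false →
            bit (toList Y) j ≡ true → toList Y ≡ (toList X [ i ]≔ false) [ j ]≔ true → IAdj (PathAdj n) X Y
move⇒IAdj X Y i j i~j bit-i bit-j bitY-j e with bit⇒element X i bit-i | bit⇒element Y j bitY-j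
... | u , refl , u∈X | v , refl , _ = u , v , i~j , u∈X , v∉X , toList-injective′ Y _ (trans e (sym (toList-move X u v)))
  where
  v∉X : v ∉ X
  v∉X v∈X with trans (sym (∈⇒bit X v v∈X)) bit-j
  ... | ()

ShiftRight⇒IAdj : (X Y : Subset n) → ShiftRight (toList X) (toList Y) → IAdj (PathAdj n) X Y × IAdj (PathAdj n) Y X
ShiftRight⇒IAdj X Y (P , S , eX , eY) =
  move⇒IAdj X Y p q (inj₁ (+-assoc (length P) 0 1)) (bit-at eX 0) (bit-at eX 1) (bit-at eY 1) (trans eY (sym (moved-at eX 0 1))) ,
  move⇒IAdj Y X q p (inj₂ (+-assoc (length P) 0 1)) (bit-at eY 1) (bit-at eY 0) (bit-at eX 0) (trans eX (sym (moved-at eY 1 0)))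
  where
  p q : ℕ
  p = length P + 0
  q = length P + 1
  bit-at : ∀ {Z cs} → toList Z ≡ P ++ cs → ∀ i → bit (toList Z) (length P + i) ≡ bit cs i
  bit-at {cs = cs} e i = trans (cong (λ bs → bit bs (length P + i)) e) (bit-++ʳ P cs i)
  moved-at : ∀ {Z cs} → toList Z ≡ P ++ cs → ∀ i j →
             (toList Z [ length P + i ]≔ false) [ length P + j ]≔ true ≡ P ++ ((cs [ i ]≔ false) [ j ]≔ true)
  moved-at {Z} {cs} e i j = begin
    (toList Z [ length P + i ]≔ false) [ length P + j ]≔ true
      ≡⟨ cong (λ bs → (bs [ length P + i ]≔ false) [ length P + j ]≔ true) e ⟩
    ((P ++ cs) [ length P + i ]≔ false) [ length P + j ]≔ true ≡⟨ cong (_[ length P + j ]≔ true) (≔-++ʳ P cs i false) ⟩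
    (P ++ (cs [ i ]≔ false)) [ length P + j ]≔ true            ≡⟨ ≔-++ʳ P (cs [ i ]≔ false) j true ⟩
    P ++ ((cs [ i ]≔ false) [ j ]≔ true)                       ∎

-- The worn lattice

-- The i-set of w_{a,b} has padded word block₂^x block₁^(y+1) block₀^z with x = a - b, y = k - a, z = b.
record Coordinates (w : LVert k) (x y z : ℕ) : Set where
  constructor coords
  field
    a≡x+z   : toℕ (proj₁ w) ≡ x + z
    b≡z     : toℕ (proj₂ w) ≡ z
    x+y+z≡k : x + y + z ≡ k

xCoord yCoord zCoord : LVert k → ℕ
xCoord (a , b)     = toℕ a ∸ toℕ b
yCoord {k} (a , b) = k ∸ toℕ a
zCoord (a , b)     = toℕ b

coordinates : (w : LVert k) → Coordinates w (xCoord w) (yCoord w) (zCoord w)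
coordinates {k} (a , b) = coords (sym (m∸n+n≡m b≤a)) refl sum
  where
  b≤a : toℕ b ≤ toℕ a
  b≤a = ≤-pred (toℕ<n b)
  sum : toℕ a ∸ toℕ b + (k ∸ toℕ a) + toℕ b ≡ k
  sum = begin
    toℕ a ∸ toℕ b + (k ∸ toℕ a) + toℕ b ≡⟨ xy∙z≈xz∙y (toℕ a ∸ toℕ b) _ _ ⟩
    toℕ a ∸ toℕ b + toℕ b + (k ∸ toℕ a) ≡⟨ cong (_+ (k ∸ toℕ a)) (m∸n+n≡m b≤a) ⟩
    toℕ a + (k ∸ toℕ a)                 ≡⟨ m+[n∸m]≡n (≤-pred (toℕ<n a)) ⟩
    k                                   ∎

Coordinates-unique : ∀ {x y z x′ y′ z′} (w : LVert k) → Coordinates w x y z → Coordinates w x′ y′ z′ →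
                     x ≡ x′ × y ≡ y′ × z ≡ z′
Coordinates-unique {x = x} {y} {z} {x′} {y′} {z′} _ (coords a≡ b≡ sum) (coords a≡′ b≡′ sum′) = x≡x′ , y≡y′ , z≡z′
  where
  z≡z′ : z ≡ z′
  z≡z′ = trans (sym b≡) b≡′
  x≡x′ : x ≡ x′
  x≡x′ = +-cancelʳ-≡ z x x′ (trans (sym a≡) (trans a≡′ (cong (x′ +_) (sym z≡z′))))
  y≡y′ : y ≡ y′
  y≡y′ = middle-cancel x y y′ z (trans sum (trans (sym sum′) (cong₂ (λ p q → p + y′ + q) (sym x≡x′) (sym z≡z′))))

Coordinates-injective : ∀ {x y z x′ y′ z′} (w w′ : LVert k) → Coordinates w x y z → Coordinates w′ x′ y′ z′ →
                        x ≡ x′ → z ≡ z′ → w ≡ w′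
Coordinates-injective (a , b) (a′ , b′) (coords a≡ b≡ _) (coords a≡′ b≡′ _) x≡x′ z≡z′
  with toℕ-injective (trans a≡ (trans (cong₂ _+_ x≡x′ z≡z′) (sym a≡′)))
... | refl = cong (a ,_) (toℕ-injective (trans b≡ (trans z≡z′ (sym b≡′))))

Coordinates-surjective : ∀ {x y z} → x + y + z ≡ k → Σ (LVert k) λ w → Coordinates w x y z
Coordinates-surjective {x = x} {y} {z} refl = (a , b) , coords (toℕ-fromℕ< x+z<1+k) (toℕ-fromℕ< z<1+a) refl
  where
  x+z<1+k : x + z < suc (x + y + z)
  x+z<1+k = s≤s (subst (x + z ≤_) (xy∙z≈xz∙y x z y) (m≤m+n (x + z) y))
  a : Fin (suc (x + y + z))
  a = fromℕ< x+z<1+k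
  z<1+a : z < suc (toℕ a)
  z<1+a = subst (λ t → z < suc t) (sym (toℕ-fromℕ< x+z<1+k)) (s≤s (m≤n+m z x))
  b : Fin (suc (toℕ a))
  b = fromℕ< z<1+a

length-isetAt : (w : LVert k) → length (isetWord (xCoord w) (yCoord w) (zCoord w)) ≡ 3 * k + 1
length-isetAt w = length-isetWord (xCoord w) (yCoord w) (zCoord w) (Coordinates.x+y+z≡k (coordinates w))

isetAt : LVert k → Subset (3 * k + 1)
isetAt w = fromBits (isetWord (xCoord w) (yCoord w) (zCoord w)) (length-isetAt w)

toList-isetAt : ∀ {x y z} (w : LVert k) → Coordinates w x y z → toList (isetAt w) ≡ isetWord x y z
toList-isetAt w c with Coordinates-unique w (coordinates w) c
... | refl , refl , refl = toList-fromBits (isetWord (xCoord w) (yCoord w) (zCoord w)) (length-isetAt w)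

padded-isetAt : ∀ {x y z} (w : LVert k) → Coordinates w x y z → pad (toList (isetAt w)) ≡ shape x y z
padded-isetAt {x = x} {y} {z} w c = trans (cong pad (toList-isetAt w c)) (pad-isetWord x y z)

∣isetAt∣ : (w : LVert k) → ∣ isetAt w ∣ ≡ suc k
∣isetAt∣ {k} w = begin
  ∣ isetAt w ∣                    ≡⟨ ∣∣≡trues (isetAt w) ⟩
  trues (toList (isetAt w))       ≡⟨ trues-pad (toList (isetAt w)) ⟨
  trues (pad (toList (isetAt w))) ≡⟨ cong trues (padded-isetAt w c) ⟩
  trues (shape x y z)             ≡⟨ Blocks-trues (shape-Blocks x y z) ⟩
  x + suc y + z                   ≡⟨ shape-size x y z (Coordinates.x+y+z≡k c) ⟩
  suc k                           ∎
  where
  x = xCoord w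
  y = yCoord w
  z = zCoord w
  c = coordinates w

isetAt-IsISet : (w : LVert k) → IsISet (PathAdj (3 * k + 1)) (isetAt w)
isetAt-IsISet {k} w = pathIDS?⇒IsIDS (isetAt w) ids , λ Y idsY → ≤-trans (≤-reflexive (∣isetAt∣ w)) (IsIDS⇒size≥ k Y idsY)
  where
  ids : pathIDS? (toList (isetAt w)) ≡ true
  ids = trans (cong (windowsOK true true) (padded-isetAt w (coordinates w))) (windowsOK-shape (xCoord w) (yCoord w) (zCoord w))

isetAt-injective : (w w′ : LVert k) → isetAt w ≡ isetAt w′ → w ≡ w′
isetAt-injective w w′ e = Coordinates-injective w w′ c c′ (proj₁ same) (proj₂ (proj₂ same))
  where
  c = coordinates w
  c′ = coordinates w′
  same : xCoord w ≡ xCoord w′ × yCoord w ≡ yCoord w′ × zCoord w ≡ zCoord w′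
  same = shape-injective (trans (sym (padded-isetAt w c)) (trans (cong (pad ∘ toList) e) (padded-isetAt w′ c′)))

IsISet⇒size≤ : (X : Subset (3 * k + 1)) → IsISet (PathAdj (3 * k + 1)) X → ∣ X ∣ ≤ suc k
IsISet⇒size≤ {k} X (_ , minimum) = ≤-trans (minimum (isetAt w₀) (proj₁ (isetAt-IsISet w₀))) (≤-reflexive (∣isetAt∣ w₀))
  where
  w₀ : LVert k
  w₀ = zero , zero

isetAt-surjective : (X : Subset (3 * k + 1)) → IsISet (PathAdj (3 * k + 1)) X → Σ (LVert k) λ w → isetAt w ≡ X
isetAt-surjective {k} X (ids , minimum) = from-shape (small-IDS⇒shape k X ids (IsISet⇒size≤ X (ids , minimum)))
  where
  from-shape : ∃[ x ] ∃[ y ] ∃[ z ] (pad (toList X) ≡ shape x y z × x + y + z ≡ k) → Σ (LVert k) λ w → isetAt w ≡ X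
  from-shape (x , y , z , padded , sum) = w , toList-injective′ (isetAt w) X (pad-injective (trans (padded-isetAt w c) (sym padded)))
    where
    w = proj₁ (Coordinates-surjective {x = x} {y} {z} sum)
    c = proj₂ (Coordinates-surjective {x = x} {y} {z} sum)

UpStep : LVert k → LVert k → Set
UpStep (a , b) (c , d) = toℕ a + 1 ≡ toℕ c × (toℕ b ≡ toℕ d ⊎ toℕ b + 1 ≡ toℕ d)

LAdj⇒UpStep : (w w′ : LVert k) → LAdj k w w′ → UpStep w w′ ⊎ UpStep w′ w
LAdj⇒UpStep _ _ (inj₁ up)                    = inj₁ up
LAdj⇒UpStep _ _ (inj₂ (a≡c+1 , inj₁ b≡d))   = inj₂ (sym a≡c+1 , inj₁ (sym b≡d))
LAdj⇒UpStep _ _ (inj₂ (a≡c+1 , inj₂ b≡d+1)) = inj₂ (sym a≡c+1 , inj₂ (sym b≡d+1))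

UpStep⇒LAdj : (w w′ : LVert k) → UpStep w w′ ⊎ UpStep w′ w → LAdj k w w′
UpStep⇒LAdj _ _ (inj₁ up)                    = inj₁ up
UpStep⇒LAdj _ _ (inj₂ (c+1≡a , inj₁ d≡b))   = inj₂ (sym c+1≡a , inj₁ (sym d≡b))
UpStep⇒LAdj _ _ (inj₂ (c+1≡a , inj₂ d+1≡b)) = inj₂ (sym c+1≡a , inj₂ (sym d+1≡b))

UpStep⇒Up : ∀ {x y z x′ y′ z′} (w w′ : LVert k) → Coordinates w x y z → Coordinates w′ x′ y′ z′ →
            UpStep w w′ → Up x z x′ z′
UpStep⇒Up (a , b) (c , d) (coords a≡ b≡ _) (coords c≡ d≡ _) (a+1≡c , step) = up a≡ b≡ c≡ d≡ a+1≡c step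
  where
  up : ∀ {A B C D x z x′ z′} → A ≡ x + z → B ≡ z → C ≡ x′ + z′ → D ≡ z′ →
       A + 1 ≡ C → B ≡ D ⊎ B + 1 ≡ D → Up x z x′ z′
  up {x = x} {z} {x′} refl refl refl refl e (inj₁ refl) = inj₁ (+-cancelʳ-≡ z x′ (suc x) (trans (sym e) (+-comm (x + z) 1)) , refl)
  up {x = x} {z} {x′} refl refl refl refl e (inj₂ refl) =
    inj₂ (+-cancelʳ-≡ (z + 1) x′ x (trans (sym e) (+-assoc x z 1)) , +-comm z 1)

Up⇒UpStep : ∀ {x y z x′ y′ z′} (w w′ : LVert k) → Coordinates w x y z → Coordinates w′ x′ y′ z′ →
            Up x z x′ z′ → UpStep w w′
Up⇒UpStep (a , b) (c , d) (coords a≡ b≡ _) (coords c≡ d≡ _) up = step a≡ b≡ c≡ d≡ up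
  where
  step : ∀ {A B C D x z x′ z′} → A ≡ x + z → B ≡ z → C ≡ x′ + z′ → D ≡ z′ →
         Up x z x′ z′ → A + 1 ≡ C × (B ≡ D ⊎ B + 1 ≡ D)
  step {x = x} {z} refl refl refl refl (inj₁ (refl , refl)) = +-comm (x + z) 1 , inj₁ refl
  step {x = x} {z} refl refl refl refl (inj₂ (refl , refl)) = trans (+-assoc x z 1) (cong (x +_) (+-comm z 1)) , inj₂ (+-comm z 1)

Up⇒IAdj : ∀ {x y z x′ y′ z′} (w w′ : LVert k) → Coordinates w x y z → Coordinates w′ x′ y′ z′ → Up x z x′ z′ →
          IAdj (PathAdj (3 * k + 1)) (isetAt w) (isetAt w′) × IAdj (PathAdj (3 * k + 1)) (isetAt w′) (isetAt w)
Up⇒IAdj {x = x} {y} {z} {y′ = y′} w w′ c c′ (inj₁ (refl , refl)) =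
  ShiftRight⇒IAdj (isetAt w) (isetAt w′) (subst₂ ShiftRight (sym word) (sym (toList-isetAt w′ c′)) (shiftRight-x x y′ z))
  where
  word : toList (isetAt w) ≡ isetWord x (suc y′) z
  word = trans (toList-isetAt w c) (cong (λ t → isetWord x t z) (middle-cancel x y (suc y′) z
           (trans (Coordinates.x+y+z≡k c) (trans (sym (Coordinates.x+y+z≡k c′)) (cong (_+ z) (sym (+-suc x y′)))))))
Up⇒IAdj {x = x} {y} {z} {y′ = y′} w w′ c c′ (inj₂ (refl , refl)) =
  swap (ShiftRight⇒IAdj (isetAt w′) (isetAt w) (subst₂ ShiftRight (sym (toList-isetAt w′ c′)) (sym word) (shiftRight-z x y′ z)))
  where
  word : toList (isetAt w) ≡ isetWord x (suc y′) z
  word = trans (toList-isetAt w c) (cong (λ t → isetWord x t z) (middle-cancel x y (suc y′) z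
           (trans (Coordinates.x+y+z≡k c) (trans (sym (Coordinates.x+y+z≡k c′)) (trans (+-suc (x + y′) z) (cong (_+ z) (sym (+-suc x y′))))))))

LAdj⇒IAdj : (w w′ : LVert k) → LAdj k w w′ → IAdj (PathAdj (3 * k + 1)) (isetAt w) (isetAt w′)
LAdj⇒IAdj {k} w w′ adj = edge (LAdj⇒UpStep w w′ adj)
  where
  c = coordinates w
  c′ = coordinates w′
  edge : UpStep w w′ ⊎ UpStep w′ w → IAdj (PathAdj (3 * k + 1)) (isetAt w) (isetAt w′)
  edge (inj₁ up) = proj₁ (Up⇒IAdj w w′ c c′ (UpStep⇒Up w w′ c c′ up))
  edge (inj₂ up) = proj₂ (Up⇒IAdj w′ w c′ c (UpStep⇒Up w′ w c′ c up))

TrueMoved⇒UpStep : (w w′ : LVert k) (i : ℕ) → TrueMoved (pad (toList (isetAt w))) (pad (toList (isetAt w′))) i (suc i) →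
                   UpStep w w′ ⊎ UpStep w′ w
TrueMoved⇒UpStep w w′ i moved =
  map⊎ (Up⇒UpStep w w′ c c′) (Up⇒UpStep w′ w c′ c)
       (shape-move i sums (subst₂ (λ s s′ → TrueMoved s s′ i (suc i)) (padded-isetAt w c) (padded-isetAt w′ c′) moved))
  where
  c = coordinates w
  c′ = coordinates w′
  sums = trans (Coordinates.x+y+z≡k c) (sym (Coordinates.x+y+z≡k c′))

IAdj⇒LAdj : (w w′ : LVert k) → IAdj (PathAdj (3 * k + 1)) (isetAt w) (isetAt w′) → LAdj k w w′
IAdj⇒LAdj w w′ adj = UpStep⇒LAdj w w′ (neighbour (IAdj⇒TrueMoved (isetAt w) (isetAt w′) adj))
  where
  neighbour : ∃[ i ] ∃[ j ] ((suc i ≡ j ⊎ suc j ≡ i) × TrueMoved (pad (toList (isetAt w))) (pad (toList (isetAt w′))) i j) →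
              UpStep w w′ ⊎ UpStep w′ w
  neighbour (i , _ , inj₁ refl , moved) = TrueMoved⇒UpStep w w′ i moved
  neighbour (_ , j , inj₂ refl , moved) =
    swap⊎ (TrueMoved⇒UpStep w′ w j (TrueMoved-sym {pad (toList (isetAt w))} {pad (toList (isetAt w′))} moved))

mainTheorem8 : (k : ℕ) → 1 ≤ k → ISetGraphIsoLattice (PathAdj (3 * k + 1)) k
mainTheorem8 k _ = isetAt , isetAt-IsISet , isetAt-injective , isetAt-surjective ,
                   λ w w′ → mk⇔ (LAdj⇒IAdj w w′) (IAdj⇒LAdj w w′)
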